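{- For all formulae $\varphi_1,\dots,\varphi_k,\theta_1,\dots,\theta_m,\psi_1,\dots,\psi_n$ of $\mathcal{L}_{\mathsf{I}}$ ($k,n\ge1$, $m\ge0$), the formula $(\varphi_1,\dots,\varphi_k)\,\mathsf{I}_{(\theta_1,\dots,\theta_m)}(\psi_1,\dots,\psi_n)$ is equivalent (true at exactly the same pairs $W,w$ with $W$ an SD-model and $w\in W$) to $$\bigwedge_{(\varphi,\theta,\psi)\in B}\Big(\big(\langle\mathsf{u}'\rangle(\theta\wedge\varphi)\wedge\langle\mathsf{u}'\rangle(\theta\wedge\psi)\big)\to\langle\mathsf{u}'\rangle(\theta\wedge\varphi\wedge\psi)\Big),$$ where $B=\mathit{Conj}(\{\varphi_1,\dots,\varphi_k\})\times\mathit{Conj}(\{\theta_1,\dots,\theta_m\})\times\mathit{Conj}(\{\psi_1,\dots,\psi_n\})$.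
   Context: Fix a countably infinite set $\mathit{PROP}$ of proposition symbols; assignments are maps $w:\mathit{PROP}\to\{0,1\}$; an SD-model is a (possibly empty) set $W$ of assignments. $\mathcal{L}_{\mathsf{I}}$: formulae $\varphi::=p\mid\neg\varphi\mid(\varphi\to\varphi)\mid(\varphi_1,\dots,\varphi_k)\,\mathsf{I}_{(\theta_1,\dots,\theta_m)}(\psi_1,\dots,\psi_n)$ ($k,n\ge1$, $m\ge0$; when $m=0$ written $(\dots)\,\mathsf{I}\,(\dots)$); $\wedge,\vee,\leftrightarrow$ usual abbreviations. Semantics: $W,w\models p$ iff $w(p)=1$; $\neg,\to$ classical; $W,w\models(\varphi_1,\dots,\varphi_k)\,\mathsf{I}_{(\theta_1,\dots,\theta_m)}(\psi_1,\dots,\psi_n)$ iff for all $w_1,w_2\in W$ agreeing on the truth (in $W$) of each $\theta_i$ there is $v\in W$ agreeing with $w_1$ on the truth of each $\theta_i$ and each $\varphi_i$ and with $w_2$ on the truth of each $\psi_i$. Abbreviations: $[\mathsf{u}']\varphi:=\varphi\wedge\varphi\,\mathsf{I}\,\varphi$ and $\langle\mathsf{u}'\rangle\varphi:=\neg[\mathsf{u}']\neg\varphi$. $\top:=p\vee\neg p$ for a fixed $p$. Types: for a finite nonempty set $\Phi=\{\chi_1,\dots,\chi_l\}$ of formulae, $\mathit{Conj}(\Phi)$ is the set of conjunctions $\pm\chi_1\wedge\dots\wedge\pm\chi_l$ (each $\chi_i$ taken either positively or negated); $\mathit{Conj}(\emptyset)=\{\top\}$. -}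

module Defs where

open import Data.Nat using (ℕ; zero)
open import Data.Bool using (Bool; true)
open import Data.List using (List; []; _∷_; map; concatMap; cartesianProduct)
open import Data.Product using (Σ; _×_; _,_)
open import Data.Unit using (⊤)
open import Relation.Nullary using (¬_)
open import Relation.Binary.PropositionalEquality using (_≡_)
open import Function.Bundles using (_⇔_)

PROP : Set
PROP = ℕ

Assignment : Set
Assignment = PROP → Bool

SDModel : Set₁
SDModel = Assignment → Set

-- Syntax of L_I.  The independence atom (φs) I_(θs) (ψs).
data Fm : Set where
  atom : PROP → Fm
  neg  : Fm → Fm
  imp  : Fm → Fm → Fm
  indep : List Fm → List Fm → List Fm → Fm

infix 4 _,_⊨_

mutual
  _,_⊨_ : SDModel → Assignment → Fm → Set
  W , w ⊨ atom p = w p ≡ true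
  W , w ⊨ neg φ = ¬ (W , w ⊨ φ)
  W , w ⊨ imp φ ψ = (W , w ⊨ φ) → (W , w ⊨ ψ)
  W , w ⊨ indep φs θs ψs =
    (w₁ w₂ : Assignment) → W w₁ → W w₂ → Agree W w₁ w₂ θs →
    Σ Assignment λ v → W v × Agree W v w₁ θs × Agree W v w₁ φs × Agree W v w₂ ψs

  Agree : SDModel → Assignment → Assignment → List Fm → Set
  Agree W u v [] = ⊤
  Agree W u v (φ ∷ φs) = ((W , u ⊨ φ) ⇔ (W , v ⊨ φ)) × Agree W u v φs

_∧_ : Fm → Fm → Fm
φ ∧ ψ = neg (imp φ (neg ψ))

_∨_ : Fm → Fm → Fm
φ ∨ ψ = imp (neg φ) ψ

infixr 6 _∧_
infixr 5 _∨_

Top : Fm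
Top = atom zero ∨ neg (atom zero)

box : Fm → Fm
box φ = φ ∧ indep (φ ∷ []) [] (φ ∷ [])

dia : Fm → Fm
dia φ = neg (box (neg φ))

ConjNE : Fm → List Fm → List Fm
ConjNE χ [] = χ ∷ neg χ ∷ []
ConjNE χ (χ' ∷ Φ) = concatMap (λ c → (χ ∧ c) ∷ (neg χ ∧ c) ∷ []) (ConjNE χ' Φ)

Conj : List Fm → List Fm
Conj [] = Top ∷ []
Conj (χ ∷ Φ) = ConjNE χ Φ

⋀ : List Fm → Fm
⋀ [] = Top
⋀ (x ∷ []) = x
⋀ (x ∷ y ∷ xs) = x ∧ ⋀ (y ∷ xs)

B : List Fm → List Fm → List Fm → List (Fm × Fm × Fm)
B φs θs ψs = cartesianProduct (Conj φs) (cartesianProduct (Conj θs) (Conj ψs))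

clause : Fm × Fm × Fm → Fm
clause (φ , θ , ψ) = imp (dia (θ ∧ φ) ∧ dia (θ ∧ ψ)) (dia (θ ∧ φ ∧ ψ))

translation : List Fm → List Fm → List Fm → Fm
translation φs θs ψs = ⋀ (map clause (B φs θs ψs))

-- Classically, a conjunction in Conj(Φ) is a complete type for Φ: it is invariant under
-- agreement on Φ, and any two assignments satisfying it agree on Φ; moreover every
-- assignment satisfies one of them.  Since ⟨u'⟩χ just says that χ is satisfiable in W,
-- the clause for (φ, θ, ψ) says: if the types θ ∧ φ and θ ∧ ψ are realised in W, so is
-- θ ∧ φ ∧ ψ.  Given w₁, w₂ agreeing on the θs, the clause for the types of w₁ on the φs
-- and θs and of w₂ on the ψs yields the witness v required by the independence atom,
-- and conversely an independence witness for two realisers realises θ ∧ φ ∧ ψ.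
module Submission where

open import Defs
open import Level using (0ℓ)
open import Data.List using (List; []; _∷_; cartesianProduct)
open import Data.List.Relation.Unary.All as All using (All; []; _∷_)
open import Data.List.Relation.Unary.Any as Any using (Any; here; there)
import Data.List.Relation.Unary.All.Properties as All
import Data.List.Relation.Unary.Any.Properties as Any
open import Data.Product using (Σ; _×_; _,_; proj₁; proj₂)
open import Data.Product.Function.NonDependent.Propositional using (_×-⇔_)
open import Data.Unit using (tt)
open import Data.Empty using (⊥-elim)
open import Relation.Nullary using (¬_; yes; no)
open import Relation.Binary.PropositionalEquality using (_≢_; setoid)
open import Function.Bundles using (_⇔_; mk⇔; Equivalence)
open import Function.Properties.Equivalence using () renaming (refl to ⇔-refl; sym to ⇔-sym; trans to ⇔-trans)
open import Axiom.ExcludedMiddle using (ExcludedMiddle)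

open Equivalence using (to; from)

All-cartesianProduct⁺ : {A B : Set} {P : A → Set} {Q : B → Set} {xs : List A} {ys : List B} →
                        All P xs → All Q ys →
                        All (λ xy → P (proj₁ xy) × Q (proj₂ xy)) (cartesianProduct xs ys)
All-cartesianProduct⁺ {xs = xs} {ys} ps qs =
  All.cartesianProduct⁺ (setoid _) (setoid _) xs ys
    (λ x∈xs y∈ys → All.lookup ps x∈xs , All.lookup qs y∈ys)

Satisfiable : SDModel → Fm → Set
Satisfiable W χ = Σ Assignment λ u → W u × (W , u ⊨ χ)

record IsType (W : SDModel) (Φ : List Fm) (χ : Fm) : Set where
  field
    respects : ∀ {u v} → Agree W u v Φ → (W , u ⊨ χ) ⇔ (W , v ⊨ χ)
    agree    : ∀ {u v} → W , u ⊨ χ → W , v ⊨ χ → Agree W u v Φ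

open IsType

IsTypeTriple : SDModel → List Fm → List Fm → List Fm → Fm × Fm × Fm → Set
IsTypeTriple W φs θs ψs (φ , θ , ψ) = IsType W φs φ × IsType W θs θ × IsType W ψs ψ

module Classical (em : ExcludedMiddle 0ℓ) where

  dne : {P : Set} → ¬ ¬ P → P
  dne {P} ¬¬p with em {P}
  ... | yes p = p
  ... | no ¬p = ⊥-elim (¬¬p ¬p)

  ⊨∧⇔ : ∀ {W u} φ ψ → (W , u ⊨ φ ∧ ψ) ⇔ ((W , u ⊨ φ) × (W , u ⊨ ψ))
  ⊨∧⇔ φ ψ = mk⇔ (λ h → dne (λ ¬φ → h (λ φ → ⊥-elim (¬φ φ))) , dne (λ ¬ψ → h (λ _ → ¬ψ)))
                 (λ (φ , ψ) h → h φ ψ)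

  ⊨⋀⇔All : ∀ {W u} φs → (W , u ⊨ ⋀ φs) ⇔ All (W , u ⊨_) φs
  ⊨⋀⇔All {W} {u} φs = mk⇔ (⋀⇒All φs) (All⇒⋀ φs)
    where
    ⋀⇒All : ∀ φs → W , u ⊨ ⋀ φs → All (W , u ⊨_) φs
    ⋀⇒All []               _ = []
    ⋀⇒All (φ ∷ [])         h = h ∷ []
    ⋀⇒All (φ ∷ φs@(_ ∷ _)) h = let (p , ps) = to (⊨∧⇔ φ (⋀ φs)) h in p ∷ ⋀⇒All φs ps

    All⇒⋀ : ∀ φs → All (W , u ⊨_) φs → W , u ⊨ ⋀ φs
    All⇒⋀ []               _        = λ ¬p → ¬p
    All⇒⋀ (φ ∷ [])         (p ∷ []) = p
    All⇒⋀ (φ ∷ φs@(_ ∷ _)) (p ∷ ps) = from (⊨∧⇔ φ (⋀ φs)) (p , All⇒⋀ φs ps)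

  -- ⟨u'⟩χ fails exactly when ¬χ holds throughout W, for then ¬χ I ¬χ holds trivially.
  ⊨dia⇔ : ∀ {W w} χ → W w → (W , w ⊨ dia χ) ⇔ Satisfiable W χ
  ⊨dia⇔ {W} {w} χ w∈W = mk⇔ satisfiable-from-dia dia-from-satisfiable
    where
    satisfiable-from-dia : W , w ⊨ dia χ → Satisfiable W χ
    satisfiable-from-dia d with em {Satisfiable W χ}
    ... | yes s = s
    ... | no ¬s = ⊥-elim (d (λ f → f (λ χw → ¬s (w , w∈W , χw))
            (λ w₁ w₂ w₁∈W w₂∈W _ → w₁ , w₁∈W , tt ,
               (⇔-refl , tt) ,
               (mk⇔ (λ _ χ → ¬s (w₂ , w₂∈W , χ)) (λ _ χ → ¬s (w₁ , w₁∈W , χ)) , tt))))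

    dia-from-satisfiable : Satisfiable W χ → W , w ⊨ dia χ
    dia-from-satisfiable (u , u∈W , χu) box¬χ = box¬χ λ ¬χw ¬χ-I-¬χ →
      let (_ , _ , _ , (v~u , _) , (v~w , _)) = ¬χ-I-¬χ u w u∈W w∈W tt
      in to v~u (from v~w ¬χw) χu

  ⊨translation⇔All : ∀ {W w} φs θs ψs →
                     (W , w ⊨ translation φs θs ψs) ⇔ All (λ t → W , w ⊨ clause t) (B φs θs ψs)
  ⊨translation⇔All φs θs ψs = ⇔-trans (⊨⋀⇔All _) (mk⇔ All.map⁻ All.map⁺)

  ⊨clause⇔ : ∀ {W w} φ θ ψ → W w →
             (W , w ⊨ clause (φ , θ , ψ)) ⇔
             (Satisfiable W (θ ∧ φ) × Satisfiable W (θ ∧ ψ) → Satisfiable W (θ ∧ φ ∧ ψ))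
  ⊨clause⇔ φ θ ψ w∈W =
    mk⇔ (λ c (s₁ , s₂) → to (⊨dia⇔ (θ ∧ φ ∧ ψ) w∈W)
                             (c (from (⊨∧⇔ (dia (θ ∧ φ)) (dia (θ ∧ ψ)))
                                  (from (⊨dia⇔ (θ ∧ φ) w∈W) s₁ , from (⊨dia⇔ (θ ∧ ψ) w∈W) s₂))))
        (λ c h → let (d₁ , d₂) = to (⊨∧⇔ (dia (θ ∧ φ)) (dia (θ ∧ ψ))) h
                 in from (⊨dia⇔ (θ ∧ φ ∧ ψ) w∈W)
                      (c (to (⊨dia⇔ (θ ∧ φ) w∈W) d₁ , to (⊨dia⇔ (θ ∧ ψ) w∈W) d₂)))

  module _ {W : SDModel} where

    atom-isType : ∀ χ → IsType W (χ ∷ []) χ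
    atom-isType χ .respects (u~v , _) = u~v
    atom-isType χ .agree χu χv = mk⇔ (λ _ → χv) (λ _ → χu) , tt

    neg-isType : ∀ χ → IsType W (χ ∷ []) (neg χ)
    neg-isType χ .respects (u~v , _) = mk⇔ (λ ¬χu χv → ¬χu (from u~v χv)) (λ ¬χv χu → ¬χv (to u~v χu))
    neg-isType χ .agree ¬χu ¬χv = mk⇔ (λ χu → ⊥-elim (¬χu χu)) (λ χv → ⊥-elim (¬χv χv)) , tt

    ∧-isType : ∀ {χ Φ δ γ} → IsType W (χ ∷ []) δ → IsType W Φ γ → IsType W (χ ∷ Φ) (δ ∧ γ)
    ∧-isType {δ = δ} {γ} tδ tγ .respects (u~v , ag) =
      ⇔-trans (⊨∧⇔ δ γ) (⇔-trans (tδ .respects (u~v , tt) ×-⇔ tγ .respects ag) (⇔-sym (⊨∧⇔ δ γ)))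
    ∧-isType {δ = δ} {γ} tδ tγ .agree h₁ h₂ =
      let (δu , γu) = to (⊨∧⇔ δ γ) h₁
          (δv , γv) = to (⊨∧⇔ δ γ) h₂
      in proj₁ (tδ .agree δu δv) , tγ .agree γu γv

    ConjNE-isType : ∀ χ Φ → All (IsType W (χ ∷ Φ)) (ConjNE χ Φ)
    ConjNE-isType χ []       = atom-isType χ ∷ neg-isType χ ∷ []
    ConjNE-isType χ (χ′ ∷ Φ) = All.concat⁺ (All.map⁺ (All.map extend (ConjNE-isType χ′ Φ)))
      where
      extend : ∀ {γ} → IsType W (χ′ ∷ Φ) γ → All (IsType W (χ ∷ χ′ ∷ Φ)) ((χ ∧ γ) ∷ (neg χ ∧ γ) ∷ [])
      extend tγ = ∧-isType (atom-isType χ) tγ ∷ ∧-isType (neg-isType χ) tγ ∷ []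

    Conj-isType : ∀ Φ → All (IsType W Φ) (Conj Φ)
    Conj-isType []      = record { respects = λ _ → mk⇔ (λ _ ¬p → ¬p) (λ _ ¬p → ¬p)
                                 ; agree    = λ _ _ → tt } ∷ []
    Conj-isType (χ ∷ Φ) = ConjNE-isType χ Φ

    ConjNE-covers : ∀ u χ Φ → Any (W , u ⊨_) (ConjNE χ Φ)
    ConjNE-covers u χ [] with em {W , u ⊨ χ}
    ... | yes χu = here χu
    ... | no ¬χu = there (here ¬χu)
    ConjNE-covers u χ (χ′ ∷ Φ) = Any.concatMap⁺ _ (Any.map extend (ConjNE-covers u χ′ Φ))
      where
      extend : ∀ {γ} → W , u ⊨ γ → Any (W , u ⊨_) ((χ ∧ γ) ∷ (neg χ ∧ γ) ∷ [])
      extend {γ} γu with em {W , u ⊨ χ}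
      ... | yes χu = here (from (⊨∧⇔ χ γ) (χu , γu))
      ... | no ¬χu = there (here (from (⊨∧⇔ (neg χ) γ) (¬χu , γu)))

    Conj-covers : ∀ u Φ → Any (W , u ⊨_) (Conj Φ)
    Conj-covers u []      = here (λ ¬p → ¬p)
    Conj-covers u (χ ∷ Φ) = ConjNE-covers u χ Φ

    B-isTypeTriple : ∀ φs θs ψs → All (IsTypeTriple W φs θs ψs) (B φs θs ψs)
    B-isTypeTriple φs θs ψs =
      All-cartesianProduct⁺ (Conj-isType φs) (All-cartesianProduct⁺ (Conj-isType θs) (Conj-isType ψs))

    indep⇒clause : ∀ {w φs θs ψs} → W w → W , w ⊨ indep φs θs ψs →
                   ∀ {t} → IsTypeTriple W φs θs ψs t → W , w ⊨ clause t
    indep⇒clause w∈W I {φ , θ , ψ} (tφ , tθ , tψ) = from (⊨clause⇔ φ θ ψ w∈W) realise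
      where
      realise : Satisfiable W (θ ∧ φ) × Satisfiable W (θ ∧ ψ) → Satisfiable W (θ ∧ φ ∧ ψ)
      realise ((u₁ , u₁∈W , h₁) , (u₂ , u₂∈W , h₂)) =
        let (θu₁ , φu₁) = to (⊨∧⇔ θ φ) h₁
            (θu₂ , ψu₂) = to (⊨∧⇔ θ ψ) h₂
            (v , v∈W , v~θu₁ , v~φu₁ , v~ψu₂) = I u₁ u₂ u₁∈W u₂∈W (tθ .agree θu₁ θu₂)
        in v , v∈W , from (⊨∧⇔ θ (φ ∧ ψ))
             (from (tθ .respects v~θu₁) θu₁ ,
              from (⊨∧⇔ φ ψ) (from (tφ .respects v~φu₁) φu₁ , from (tψ .respects v~ψu₂) ψu₂))

    clause⇒independenceWitness :
      ∀ {w φs θs ψs φ θ ψ w₁ w₂} → W w → W , w ⊨ clause (φ , θ , ψ) →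
      IsTypeTriple W φs θs ψs (φ , θ , ψ) →
      W w₁ → W w₂ → Agree W w₁ w₂ θs → W , w₁ ⊨ φ → W , w₁ ⊨ θ → W , w₂ ⊨ ψ →
      Σ Assignment λ v → W v × Agree W v w₁ θs × Agree W v w₁ φs × Agree W v w₂ ψs
    clause⇒independenceWitness {φ = φ} {θ} {ψ} {w₁} {w₂} w∈W c (tφ , tθ , tψ)
                               w₁∈W w₂∈W w₁~θw₂ φw₁ θw₁ ψw₂ =
      let (v , v∈W , h) = to (⊨clause⇔ φ θ ψ w∈W) c
            ((w₁ , w₁∈W , from (⊨∧⇔ θ φ) (θw₁ , φw₁)) ,
             (w₂ , w₂∈W , from (⊨∧⇔ θ ψ) (to (tθ .respects w₁~θw₂) θw₁ , ψw₂)))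
          (θv , φψv) = to (⊨∧⇔ θ (φ ∧ ψ)) h
          (φv , ψv) = to (⊨∧⇔ φ ψ) φψv
      in v , v∈W , tθ .agree θv θw₁ , tφ .agree φv φw₁ , tψ .agree ψv ψw₂

    clauses⇒indep : ∀ {w} φs θs ψs → W w → All (λ t → W , w ⊨ clause t) (B φs θs ψs) →
                    W , w ⊨ indep φs θs ψs
    clauses⇒indep φs θs ψs w∈W clauses w₁ w₂ w₁∈W w₂∈W w₁~θw₂ =
      let types-of-w₁w₂ = Any.cartesianProduct⁺ (Conj-covers w₁ φs)
                            (Any.cartesianProduct⁺ (Conj-covers w₁ θs) (Conj-covers w₂ ψs))
          (types , c) , (φw₁ , θw₁ , ψw₂) =
            All.lookupAny (All.zip (B-isTypeTriple φs θs ψs , clauses)) types-of-w₁w₂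
      in clause⇒independenceWitness w∈W c types w₁∈W w₂∈W w₁~θw₂ φw₁ θw₁ ψw₂

open Classical

proposition4p4 : ExcludedMiddle 0ℓ →
    (φs θs ψs : List Fm) → φs ≢ [] → ψs ≢ [] →
    (W : SDModel) (w : Assignment) → W w →
    (W , w ⊨ indep φs θs ψs) ⇔ (W , w ⊨ translation φs θs ψs)
proposition4p4 em φs θs ψs _ _ W w w∈W =
  ⇔-trans (mk⇔ (λ I → All.map (indep⇒clause em w∈W I) (B-isTypeTriple em φs θs ψs))
               (clauses⇒indep em φs θs ψs w∈W))
          (⇔-sym (⊨translation⇔All em φs θs ψs))
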